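{- Let $\Sigma$ be a finite alphabet and let $S=\{s_1,s_2\}$ be a set of two strings in $\Sigma^n$. Then Algorithm A (described in the context), run on $S$, always outputs an exact solution of the closest string problem for $S$, i.e. a string $t\in\Sigma^n$ with $\max(d(t,s_1),d(t,s_2))=\min_{u\in\Sigma^n}\max(d(u,s_1),d(u,s_2))$.
   Context: For equal-length strings $s,t$, $d(s,t)$ is the Hamming distance (number of positions $i$ with $s[i]\neq t[i]$). The closest string problem (CSP): given $S=\{s_1,\dots,s_m\}\subseteq\Sigma^n$, find $t\in\Sigma^n$ minimizing $d$ subject to $d(t,s_i)\le d$ for all $i$. It is formulated as the integer program: minimize $d$ subject to $\sum_{a\in\Sigma}x_{a,j}=1$ for $j=1,\dots,n$, and $n-\sum_{j=1}^n x_{s_i[j],j}\le d$ for $i=1,\dots,m$, with $x_{a,j}\in\{0,1\}$ and $d$ a nonnegative integer ($x_{a,j}=1$ means $t[j]=a$). Its LP relaxation replaces $x_{a,j}\in\{0,1\}$ by $0\le x_{a,j}\le 1$ and lets $d$ be real. Algorithm A: start with $V_1=V_0=\emptyset$. For $i=1,\dots,n$: fix all variables in $V_1$ to $1$ and all variables in $V_0$ to $0$; solve the LP relaxation in the remaining (unfixed) variables; pick a variable $x_{b,k}$ not in $V_1$ having the largest value in this LP optimal solution; add $x_{b,k}$ to $V_1$ and add all $x_{a,k}$ with $a\neq b$ to $V_0$. Finally output the string $t$ with $t[k]=a$ for every $x_{a,k}\in V_1$.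
   Formalization: In every iteration of Algorithm A the optimal solutions of the LP relaxation are taken over the rationals rather than the reals, with rational values of the variables $x_{a,j}$ and of $d$. -}

module Defs where

open import Data.Nat as ℕ using (ℕ; zero; suc)
open import Data.Fin using (Fin; zero; suc)
open import Data.Maybe using (Maybe; just; nothing)
open import Data.Integer using (+_)
open import Data.Rational using (ℚ; 0ℚ; 1ℚ; _+_; _-_; _≤_; _/_)
open import Data.Product using (Σ; ∃; _×_; _,_)
open import Relation.Binary.PropositionalEquality using (_≡_; _≢_)
open import Relation.Nullary using (¬_)

Str : ℕ → ℕ → Set
Str q n = Fin n → Fin q

hamming : ∀ {q n} → Str q n → Str q n → ℕ
hamming {q} {zero}  s t = 0
hamming {q} {suc n} s t with s zero Data.Fin.≟ t zero
... | Relation.Nullary.yes _ = hamming (λ j → s (suc j)) (λ j → t (suc j))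
... | Relation.Nullary.no  _ = suc (hamming (λ j → s (suc j)) (λ j → t (suc j)))

cost : ∀ {q n} → Str q n → Str q n → Str q n → ℕ
cost s₁ s₂ t = hamming t s₁ ℕ.⊔ hamming t s₂

IsClosest : ∀ {q n} → Str q n → Str q n → Str q n → Set
IsClosest {q} {n} s₁ s₂ t = (u : Str q n) → cost s₁ s₂ t ℕ.≤ cost s₁ s₂ u

sumℚ : ∀ {k} → (Fin k → ℚ) → ℚ
sumℚ {zero}  f = 0ℚ
sumℚ {suc k} f = f zero + sumℚ (λ i → f (suc i))

ℕtoℚ : ℕ → ℚ
ℕtoℚ m = + m / 1

-- State of Algorithm A: F k ≡ just a  means  x_{a,k} ∈ V₁
-- (and then x_{a',k} ∈ V₀ for all a' ≠ a).
State : ℕ → ℕ → Set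
State q n = Fin n → Maybe (Fin q)

initial : ∀ {q n} → State q n
initial _ = nothing

InV₁ : ∀ {q n} → State q n → Fin q → Fin n → Set
InV₁ F a k = F k ≡ just a

LPVars : ℕ → ℕ → Set
LPVars q n = Fin q → Fin n → ℚ

-- Feasibility for the LP relaxation of the CSP IP for {s₁, s₂}, with the
-- variables of V₁ fixed to 1 and those of V₀ fixed to 0.
Feasible : ∀ {q n} → Str q n → Str q n → State q n → LPVars q n → ℚ → Set
Feasible {q} {n} s₁ s₂ F x d =
    (∀ a j → 0ℚ ≤ x a j × x a j ≤ 1ℚ)
  × (∀ j → sumℚ (λ a → x a j) ≡ 1ℚ)
  × (ℕtoℚ n - sumℚ (λ j → x (s₁ j) j) ≤ d)
  × (ℕtoℚ n - sumℚ (λ j → x (s₂ j) j) ≤ d)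
  × (∀ a j → InV₁ F a j → x a j ≡ 1ℚ)
  × (∀ a b j → InV₁ F b j → a ≢ b → x a j ≡ 0ℚ)

LPOptimal : ∀ {q n} → Str q n → Str q n → State q n → LPVars q n → ℚ → Set
LPOptimal {q} {n} s₁ s₂ F x d =
  Feasible s₁ s₂ F x d × (∀ x' d' → Feasible s₁ s₂ F x' d' → d ≤ d')

-- One iteration of Algorithm A, from state F to state F'
-- (any LP optimum, any maximal variable not in V₁: every tie-break allowed).
Step : ∀ {q n} → Str q n → Str q n → State q n → State q n → Set
Step {q} {n} s₁ s₂ F F' =
  Σ (LPVars q n) λ x → Σ ℚ λ d → LPOptimal s₁ s₂ F x d ×
  Σ (Fin q) λ b → Σ (Fin n) λ k →
      ¬ InV₁ F b k
    × (∀ a j → ¬ InV₁ F a j → x a j ≤ x b k)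
    × F' k ≡ just b
    × (∀ j → j ≢ k → F' j ≡ F j)

IsRun : ∀ {q n} → Str q n → Str q n → (ℕ → State q n) → Set
IsRun {q} {n} s₁ s₂ run =
  run 0 ≡ initial × (∀ i → i ℕ.< n → Step s₁ s₂ (run i) (run (suc i)))

Output : ∀ {q n} → State q n → Str q n → Set
Output F t = ∀ k → F k ≡ just (t k)

module Submission where

-- Write m₁, m₂ for the number of fixed positions whose letter differs from
-- s₁, resp. s₂, and U for the number of free positions where s₁ and s₂
-- differ.  The LP at a state has optimum max(m₂, m₁, (m₁ + m₂ + U)/2): the
-- mixtures that put weight α on s₁ and 1 - α on s₂ at every free position
-- attain it, and summing the per-position lower bounds of the constraints
-- shows that every optimum is tight at every free position.  Hence the
-- chosen variable is positive, lies at a free position, and selects the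
-- letter of s₁ or s₂ there, moving away from a string only if that string
-- has slack (m₁ < m₂ + U, resp. m₂ < m₁ + U).  This preserves the invariant
-- |m₁ - m₂| ≤ U + 1.  After n iterations the output agrees everywhere with
-- s₁ or s₂ and its distances to them differ by at most one, which by the
-- triangle inequality makes it a closest string.

open import Defs
open import Data.Nat as ℕ using (ℕ; zero; suc)
import Data.Nat.Properties as ℕP
open import Data.Fin using (Fin; zero; suc; _≟_)
open import Data.Fin.Properties using (suc-injective)
open import Data.Bool using (if_then_else_)
open import Data.Maybe using (Maybe; just; nothing)
open import Data.Maybe.Properties using (just-injective)
import Data.Integer as ℤ
import Data.Integer.Properties as ℤP
open import Data.Rational
  using (ℚ; 0ℚ; 1ℚ; _+_; _-_; _*_; -_; _≤_; _<_; 1/_; NonZero; Positive; nonNegative; toℚᵘ)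
open import Data.Rational.Properties hiding (_≟_)
import Data.Rational.Unnormalised as ℚᵘ
import Data.Rational.Unnormalised.Properties as ℚᵘP
open import Data.Rational.Solver using (module +-*-Solver)
open +-*-Solver
open import Algebra.Properties.CommutativeMonoid.Sum ℕP.+-0-commutativeMonoid
  using (sum; sum-cong-≗; ∑-distrib-+; sum-replicate-zero)
open import Data.Product using (Σ; _×_; _,_; proj₁; proj₂)
open import Data.Sum using (_⊎_; inj₁; inj₂)
open import Data.Empty using (⊥-elim)
open import Relation.Nullary using (¬_; does; yes; no)
open import Relation.Binary.PropositionalEquality

0≤1 : 0ℚ ≤ 1ℚ
0≤1 = <⇒≤ (positive⁻¹ 1ℚ)

+-cancelˡ-≤ : ∀ c {a b} → c + a ≤ c + b → a ≤ b
+-cancelˡ-≤ c {a} {b} c+a≤c+b = subst₂ _≤_ (neg-c+[c+x] a) (neg-c+[c+x] b) (+-monoʳ-≤ (- c) c+a≤c+b)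
  where
  neg-c+[c+x] : ∀ x → (- c) + (c + x) ≡ x
  neg-c+[c+x] = solve 2 (λ c x → (:- c) :+ (c :+ x) := x) refl c

+-cancelʳ-≤ : ∀ c {a b} → a + c ≤ b + c → a ≤ b
+-cancelʳ-≤ c {a} {b} a+c≤b+c = +-cancelˡ-≤ c (subst₂ _≤_ (+-comm a c) (+-comm b c) a+c≤b+c)

≤⇒0≤- : ∀ {a b} → a ≤ b → 0ℚ ≤ b - a
≤⇒0≤- {a} {b} a≤b = subst (_≤ b - a) (+-inverseʳ a) (+-monoˡ-≤ (- a) a≤b)

-≤0⇒≤ : ∀ {a b} → b - a ≤ 0ℚ → b ≤ a
-≤0⇒≤ {a} {b} b-a≤0 = subst₂ _≤_ (b-a+a b a) (+-identityˡ a) (+-monoˡ-≤ a b-a≤0)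
  where
  b-a+a : ∀ b a → (b - a) + a ≡ b
  b-a+a = solve 2 (λ b a → (b :- a) :+ a := b) refl

≤-+-nonneg : ∀ {a b} → 0ℚ ≤ b → a ≤ a + b
≤-+-nonneg {a} {b} 0≤b = subst (_≤ a + b) (+-identityʳ a) (+-monoʳ-≤ a 0≤b)

positive⇒≰0 : ∀ {a} → 0ℚ < a → ¬ (a ≤ 0ℚ)
positive⇒≰0 0<a a≤0 = <-irrefl refl (<-≤-trans 0<a a≤0)

complements-sum : ∀ a b → (1ℚ - a) + (1ℚ - b) ≡ 1ℚ + (1ℚ - (a + b))
complements-sum = solve 2 (λ a b → (con 1ℚ :- a) :+ (con 1ℚ :- b) := con 1ℚ :+ (con 1ℚ :- (a :+ b))) refl

-- The cast ℕ → ℚ is additive; it is computed through the unnormalised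
-- rationals, where addition of integers over denominator 1 is literal.
ℕtoℚ-+ : ∀ a b → ℕtoℚ (a ℕ.+ b) ≡ ℕtoℚ a + ℕtoℚ b
ℕtoℚ-+ a b = toℚᵘ-injective (begin
  toℚᵘ (ℕtoℚ (a ℕ.+ b))                        ≈⟨ toℚᵘ-fromℚᵘ (over1 (a ℕ.+ b)) ⟩
  over1 (a ℕ.+ b)                              ≈⟨ ℚᵘ.*≡* (cross-multiplied {ℤ.+ a} {ℤ.+ b} (ℤP.pos-+ a b)) ⟩
  over1 a ℚᵘ.+ over1 b                         ≈⟨ ℚᵘP.+-cong (ℚᵘP.≃-sym (toℚᵘ-fromℚᵘ (over1 a)))
                                                             (ℚᵘP.≃-sym (toℚᵘ-fromℚᵘ (over1 b))) ⟩
  toℚᵘ (ℕtoℚ a) ℚᵘ.+ toℚᵘ (ℕtoℚ b)              ≈⟨ ℚᵘP.≃-sym (toℚᵘ-homo-+ (ℕtoℚ a) (ℕtoℚ b)) ⟩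
  toℚᵘ (ℕtoℚ a + ℕtoℚ b)                       ∎)
  where
  open ℚᵘP.≃-Reasoning
  over1 : ℕ → ℚᵘ.ℚᵘ
  over1 m = ℚᵘ.mkℚᵘ (ℤ.+ m) 0
  cross-multiplied : ∀ {i j k} → k ≡ i ℤ.+ j →
                     k ℤ.* (ℤ.1ℤ ℤ.* ℤ.1ℤ) ≡ (i ℤ.* ℤ.1ℤ ℤ.+ j ℤ.* ℤ.1ℤ) ℤ.* ℤ.1ℤ
  cross-multiplied {i} {j} refl = trans (ℤP.*-identityʳ (i ℤ.+ j))
    (sym (trans (ℤP.*-identityʳ _) (cong₂ ℤ._+_ (ℤP.*-identityʳ i) (ℤP.*-identityʳ j))))

ℕtoℚ-nonneg : ∀ m → 0ℚ ≤ ℕtoℚ m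
ℕtoℚ-nonneg m = nonNegative⁻¹ (ℕtoℚ m) {{normalize-nonNeg m 1}}

ℕtoℚ-mono : ∀ {a b} → a ℕ.≤ b → ℕtoℚ a ≤ ℕtoℚ b
ℕtoℚ-mono {a} a≤b with ℕP.m≤n⇒∃[o]m+o≡n a≤b
... | c , refl = subst (ℕtoℚ a ≤_) (sym (ℕtoℚ-+ a c)) (≤-+-nonneg (ℕtoℚ-nonneg c))

-- Letters.  mismatch a b is the Hamming distance of the one-letter words
-- a and b; same a b is the rational 0/1 indicator of a ≡ b, i.e. the
-- value of the LP variable x_{a,j} that encodes the choice t[j] = b.

mismatch : ∀ {q} → Fin q → Fin q → ℕ
mismatch a b = if does (a ≟ b) then 0 else 1

same : ∀ {q} → Fin q → Fin q → ℚ
same a b = if does (a ≟ b) then 1ℚ else 0ℚ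

mismatch-refl : ∀ {q} (a : Fin q) → mismatch a a ≡ 0
mismatch-refl a with a ≟ a
... | yes _ = refl
... | no a≢a = ⊥-elim (a≢a refl)

mismatch-≢ : ∀ {q} {a b : Fin q} → a ≢ b → mismatch a b ≡ 1
mismatch-≢ {a = a} {b} a≢b with a ≟ b
... | yes a≡b = ⊥-elim (a≢b a≡b)
... | no _ = refl

mismatch-sym : ∀ {q} (a b : Fin q) → mismatch a b ≡ mismatch b a
mismatch-sym a b with a ≟ b | b ≟ a
... | yes _    | yes _    = refl
... | no _     | no _     = refl
... | yes refl | no a≢a   = ⊥-elim (a≢a refl)
... | no a≢a   | yes refl = ⊥-elim (a≢a refl)

mismatch-triangle : ∀ {q} (a b c : Fin q) → mismatch a c ℕ.≤ mismatch b a ℕ.+ mismatch b c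
mismatch-triangle a b c with a ≟ c | b ≟ a
... | yes _    | _        = ℕ.z≤n
... | no _     | no _     = ℕ.s≤s ℕ.z≤n
... | no a≢c   | yes refl = ℕP.≤-reflexive (sym (mismatch-≢ a≢c))

same-refl : ∀ {q} (a : Fin q) → same a a ≡ 1ℚ
same-refl a with a ≟ a
... | yes _ = refl
... | no a≢a = ⊥-elim (a≢a refl)

same-≢ : ∀ {q} {a b : Fin q} → a ≢ b → same a b ≡ 0ℚ
same-≢ {a = a} {b} a≢b with a ≟ b
... | yes a≡b = ⊥-elim (a≢b a≡b)
... | no _ = refl

same-sym : ∀ {q} (a b : Fin q) → same a b ≡ same b a
same-sym a b with a ≟ b | b ≟ a
... | yes _    | yes _    = refl
... | no _     | no _     = refl
... | yes refl | no a≢a   = ⊥-elim (a≢a refl)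
... | no a≢a   | yes refl = ⊥-elim (a≢a refl)

same-bounds : ∀ {q} (a b : Fin q) → 0ℚ ≤ same a b × same a b ≤ 1ℚ
same-bounds a b with a ≟ b
... | yes _ = 0≤1 , ≤-refl
... | no _  = ≤-refl , 0≤1

one-minus-same : ∀ {q} (a b : Fin q) → 1ℚ - same a b ≡ ℕtoℚ (mismatch a b)
one-minus-same a b with a ≟ b
... | yes _ = refl
... | no _  = refl

sum-mono : ∀ {k} {f g : Fin k → ℕ} → (∀ j → f j ℕ.≤ g j) → sum f ℕ.≤ sum g
sum-mono {zero}  f≤g = ℕ.z≤n
sum-mono {suc k} f≤g = ℕP.+-mono-≤ (f≤g zero) (sum-mono (λ j → f≤g (suc j)))

sum-update : ∀ {k} (i : Fin k) (f g : Fin k → ℕ) → (∀ j → j ≢ i → f j ≡ g j) → g i ≡ 0 →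
             sum f ≡ sum g ℕ.+ f i
sum-update zero f g agree g0≡0 = begin
  f zero ℕ.+ sum (λ j → f (suc j)) ≡⟨ cong (f zero ℕ.+_) (sum-cong-≗ (λ j → agree (suc j) λ ())) ⟩
  f zero ℕ.+ sum (λ j → g (suc j)) ≡⟨ ℕP.+-comm (f zero) _ ⟩
  sum (λ j → g (suc j)) ℕ.+ f zero ≡⟨ cong (λ z → z ℕ.+ sum (λ j → g (suc j)) ℕ.+ f zero) (sym g0≡0) ⟩
  sum g ℕ.+ f zero ∎
  where open ≡-Reasoning
sum-update (suc i) f g agree gi≡0 = begin
  f zero ℕ.+ sum (λ j → f (suc j)) ≡⟨ cong₂ ℕ._+_ (agree zero λ ())
                                       (sum-update i (λ j → f (suc j)) (λ j → g (suc j))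
                                          (λ j j≢i → agree (suc j) (λ p → j≢i (suc-injective p))) gi≡0) ⟩
  g zero ℕ.+ (sum (λ j → g (suc j)) ℕ.+ f (suc i)) ≡⟨ sym (ℕP.+-assoc (g zero) _ _) ⟩
  sum g ℕ.+ f (suc i) ∎
  where open ≡-Reasoning

hamming≡sum : ∀ {q n} (s t : Str q n) → hamming s t ≡ sum (λ j → mismatch (s j) (t j))
hamming≡sum {n = zero}  s t = refl
hamming≡sum {n = suc n} s t with s zero ≟ t zero
... | yes _ = hamming≡sum (λ j → s (suc j)) (λ j → t (suc j))
... | no _  = cong suc (hamming≡sum (λ j → s (suc j)) (λ j → t (suc j)))

sumℚ-cong : ∀ {k} {f g : Fin k → ℚ} → (∀ j → f j ≡ g j) → sumℚ f ≡ sumℚ g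
sumℚ-cong {zero}  f≗g = refl
sumℚ-cong {suc k} f≗g = cong₂ _+_ (f≗g zero) (sumℚ-cong (λ j → f≗g (suc j)))

sumℚ-zero : ∀ {k} → sumℚ {k} (λ _ → 0ℚ) ≡ 0ℚ
sumℚ-zero {zero}  = refl
sumℚ-zero {suc k} = trans (+-identityˡ _) (sumℚ-zero {k})

sumℚ-+ : ∀ {k} (f g : Fin k → ℚ) → sumℚ (λ j → f j + g j) ≡ sumℚ f + sumℚ g
sumℚ-+ {zero}  f g = refl
sumℚ-+ {suc k} f g = trans (cong ((f zero + g zero) +_) (sumℚ-+ (λ j → f (suc j)) (λ j → g (suc j))))
                          (interchange (f zero) (g zero) _ _)
  where
  interchange : ∀ a b c d → (a + b) + (c + d) ≡ (a + c) + (b + d)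
  interchange = solve 4 (λ a b c d → (a :+ b) :+ (c :+ d) := (a :+ c) :+ (b :+ d)) refl

sumℚ-*ˡ : ∀ {k} c (f : Fin k → ℚ) → sumℚ (λ j → c * f j) ≡ c * sumℚ f
sumℚ-*ˡ {zero}  c f = sym (*-zeroʳ c)
sumℚ-*ˡ {suc k} c f = trans (cong (c * f zero +_) (sumℚ-*ˡ c (λ j → f (suc j))))
                           (sym (*-distribˡ-+ c (f zero) _))

sumℚ-complement : ∀ {n} (f : Fin n → ℚ) → sumℚ (λ j → 1ℚ - f j) ≡ ℕtoℚ n - sumℚ f
sumℚ-complement {zero}  f = refl
sumℚ-complement {suc n} f = begin
  (1ℚ - f zero) + sumℚ (λ j → 1ℚ - f (suc j)) ≡⟨ cong ((1ℚ - f zero) +_) (sumℚ-complement (λ j → f (suc j))) ⟩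
  (1ℚ - f zero) + (ℕtoℚ n - sumℚ (λ j → f (suc j))) ≡⟨ regroup (f zero) (ℕtoℚ n) _ ⟩
  (1ℚ + ℕtoℚ n) - (f zero + sumℚ (λ j → f (suc j))) ≡⟨ cong (_- sumℚ f) (sym (ℕtoℚ-+ 1 n)) ⟩
  ℕtoℚ (suc n) - sumℚ f ∎
  where
  open ≡-Reasoning
  regroup : ∀ a m s → (1ℚ - a) + (m - s) ≡ (1ℚ + m) - (a + s)
  regroup = solve 3 (λ a m s → (con 1ℚ :- a) :+ (m :- s) := (con 1ℚ :+ m) :- (a :+ s)) refl

sumℚ-mono : ∀ {k} {f g : Fin k → ℚ} → (∀ j → f j ≤ g j) → sumℚ f ≤ sumℚ g
sumℚ-mono {zero}  f≤g = ≤-refl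
sumℚ-mono {suc k} f≤g = +-mono-≤ (f≤g zero) (sumℚ-mono (λ j → f≤g (suc j)))

sumℚ-nonneg : ∀ {k} (f : Fin k → ℚ) → (∀ i → 0ℚ ≤ f i) → 0ℚ ≤ sumℚ f
sumℚ-nonneg {zero}  f 0≤f = ≤-refl
sumℚ-nonneg {suc k} f 0≤f = +-mono-≤ (0≤f zero) (sumℚ-nonneg (λ j → f (suc j)) (λ j → 0≤f (suc j)))

sumℚ-ℕtoℚ : ∀ {k} (g : Fin k → ℕ) → sumℚ (λ j → ℕtoℚ (g j)) ≡ ℕtoℚ (sum g)
sumℚ-ℕtoℚ {zero}  g = refl
sumℚ-ℕtoℚ {suc k} g = trans (cong (ℕtoℚ (g zero) +_) (sumℚ-ℕtoℚ (λ j → g (suc j))))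
                            (sym (ℕtoℚ-+ (g zero) _))

pointwise-≤-of-sum : ∀ {k} (f g : Fin k → ℚ) → (∀ j → g j ≤ f j) → sumℚ f ≤ sumℚ g →
                     ∀ i → f i ≤ g i
pointwise-≤-of-sum {suc k} f g g≤f Σf≤Σg zero =
  +-cancelʳ-≤ (sumℚ (λ j → g (suc j)))
    (≤-trans (+-monoʳ-≤ (f zero) (sumℚ-mono (λ j → g≤f (suc j)))) Σf≤Σg)
pointwise-≤-of-sum {suc k} f g g≤f Σf≤Σg (suc i) =
  pointwise-≤-of-sum (λ j → f (suc j)) (λ j → g (suc j)) (λ j → g≤f (suc j))
    (+-cancelˡ-≤ (g zero) (≤-trans (+-monoˡ-≤ _ (g≤f zero)) Σf≤Σg)) i

summand-≤-sum : ∀ {k} (f : Fin k → ℚ) → (∀ i → 0ℚ ≤ f i) → ∀ c → f c ≤ sumℚ f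
summand-≤-sum {suc k} f 0≤f zero = ≤-+-nonneg (sumℚ-nonneg (λ j → f (suc j)) (λ j → 0≤f (suc j)))
summand-≤-sum {suc k} f 0≤f (suc c) =
  ≤-trans (summand-≤-sum (λ j → f (suc j)) (λ j → 0≤f (suc j)) c)
          (subst (_≤ f zero + sumℚ (λ j → f (suc j))) (+-identityˡ _) (+-monoˡ-≤ _ (0≤f zero)))

without : ∀ {k} → Fin k → (Fin k → ℚ) → Fin k → ℚ
without a f i = if does (i ≟ a) then 0ℚ else f i

sumℚ-without : ∀ {k} (a : Fin k) (f : Fin k → ℚ) → sumℚ f ≡ f a + sumℚ (without a f)
sumℚ-without {suc k} zero    f = cong (f zero +_) (sym (+-identityˡ _))
sumℚ-without {suc k} (suc a) f =
  trans (cong (f zero +_) (sumℚ-without a (λ j → f (suc j)))) (swap-front (f zero) (f (suc a)) _)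
  where
  swap-front : ∀ x y z → x + (y + z) ≡ y + (x + z)
  swap-front = solve 3 (λ x y z → x :+ (y :+ z) := y :+ (x :+ z)) refl

without-nonneg : ∀ {k} (a : Fin k) (f : Fin k → ℚ) → (∀ i → 0ℚ ≤ f i) → ∀ i → 0ℚ ≤ without a f i
without-nonneg a f 0≤f i with i ≟ a
... | yes _ = ≤-refl
... | no _  = 0≤f i

without-≢ : ∀ {k} (a : Fin k) (f : Fin k → ℚ) {i} → i ≢ a → without a f i ≡ f i
without-≢ a f {i} i≢a with i ≟ a
... | yes i≡a = ⊥-elim (i≢a i≡a)
... | no _    = refl

IsDistribution : ∀ {q} → (Fin q → ℚ) → Set
IsDistribution p = (∀ a → 0ℚ ≤ p a) × sumℚ p ≡ 1ℚ

pair-≤-sum : ∀ {q} (p : Fin q → ℚ) → (∀ a → 0ℚ ≤ p a) → ∀ {a c} → a ≢ c →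
             p a + p c ≤ sumℚ p
pair-≤-sum p 0≤p {a} {c} a≢c = subst (p a + p c ≤_) (sym (sumℚ-without a p))
  (+-monoʳ-≤ (p a) (subst (_≤ sumℚ (without a p)) (without-≢ a p (λ c≡a → a≢c (sym c≡a)))
    (summand-≤-sum (without a p) (without-nonneg a p 0≤p) c)))

triple-≤-sum : ∀ {q} (p : Fin q → ℚ) → (∀ a → 0ℚ ≤ p a) → ∀ {a b c} → a ≢ b → a ≢ c → b ≢ c →
               p a + (p b + p c) ≤ sumℚ p
triple-≤-sum p 0≤p {a} {b} {c} a≢b a≢c b≢c = subst (p a + (p b + p c) ≤_) (sym (sumℚ-without a p))
  (+-monoʳ-≤ (p a) (subst (_≤ sumℚ (without a p))
    (cong₂ _+_ (without-≢ a p (λ b≡a → a≢b (sym b≡a))) (without-≢ a p (λ c≡a → a≢c (sym c≡a))))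
    (pair-≤-sum (without a p) (without-nonneg a p 0≤p) b≢c)))

support-single : ∀ {q} {p : Fin q → ℚ} → IsDistribution p → ∀ {b c} → 1ℚ ≤ p c → 0ℚ < p b → b ≡ c
support-single {p = p} (0≤p , Σp≡1) {b} {c} 1≤pc 0<pb with b ≟ c
... | yes b≡c = b≡c
... | no b≢c  = ⊥-elim (positive⇒≰0 0<pb (+-cancelʳ-≤ 1ℚ (begin
  p b + 1ℚ   ≤⟨ +-monoʳ-≤ (p b) 1≤pc ⟩
  p b + p c  ≤⟨ pair-≤-sum p 0≤p b≢c ⟩
  sumℚ p     ≡⟨ Σp≡1 ⟩
  1ℚ         ≡⟨ +-identityˡ 1ℚ ⟨
  0ℚ + 1ℚ    ∎)))
  where open ≤-Reasoning

support-pair : ∀ {q} {p : Fin q → ℚ} → IsDistribution p → ∀ {b u v} → u ≢ v →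
               1ℚ ≤ p u + p v → 0ℚ < p b → b ≡ u ⊎ b ≡ v
support-pair {p = p} (0≤p , Σp≡1) {b} {u} {v} u≢v 1≤pu+pv 0<pb with b ≟ u | b ≟ v
... | yes b≡u | _       = inj₁ b≡u
... | no _    | yes b≡v = inj₂ b≡v
... | no b≢u  | no b≢v  = ⊥-elim (positive⇒≰0 0<pb (+-cancelʳ-≤ 1ℚ (begin
  p b + 1ℚ           ≤⟨ +-monoʳ-≤ (p b) 1≤pu+pv ⟩
  p b + (p u + p v)  ≤⟨ triple-≤-sum p 0≤p b≢u b≢v u≢v ⟩
  sumℚ p             ≡⟨ Σp≡1 ⟩
  1ℚ                 ≡⟨ +-identityˡ 1ℚ ⟨
  0ℚ + 1ℚ            ∎)))
  where open ≤-Reasoning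

positive-entry : ∀ {k} (f : Fin k → ℚ) → 0ℚ < sumℚ f → Σ (Fin k) λ a → 0ℚ < f a
positive-entry {zero}  f 0<0 = ⊥-elim (<-irrefl refl 0<0)
positive-entry {suc k} f 0<Σf with 0ℚ <? f zero | 0ℚ <? sumℚ (λ j → f (suc j))
... | yes 0<f₀ | _       = zero , 0<f₀
... | no _     | yes 0<Σ = let a , 0<fa = positive-entry (λ j → f (suc j)) 0<Σ in suc a , 0<fa
... | no 0≮f₀  | no 0≮Σ  = ⊥-elim (positive⇒≰0 0<Σf (+-mono-≤ (≮⇒≥ 0≮f₀) (≮⇒≥ 0≮Σ)))

entry-≤-1 : ∀ {q} {p : Fin q → ℚ} → IsDistribution p → ∀ a → p a ≤ 1ℚ
entry-≤-1 {p = p} (0≤p , Σp≡1) a = subst (p a ≤_) Σp≡1 (summand-≤-sum p 0≤p a)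

mismatch-≤-complements : ∀ {q} {p : Fin q → ℚ} → IsDistribution p → ∀ u v →
                         ℕtoℚ (mismatch u v) ≤ (1ℚ - p u) + (1ℚ - p v)
mismatch-≤-complements {p = p} dist u v with u ≟ v
... | yes refl = +-mono-≤ (≤⇒0≤- (entry-≤-1 dist u)) (≤⇒0≤- (entry-≤-1 dist u))
... | no u≢v   = subst₂ _≤_ (+-identityʳ 1ℚ) (sym (complements-sum (p u) (p v)))
                   (+-monoʳ-≤ 1ℚ (≤⇒0≤- (subst (p u + p v ≤_) (proj₂ dist) (pair-≤-sum p (proj₁ dist) u≢v))))

support-of-tight-complements : ∀ {q} {p : Fin q → ℚ} → IsDistribution p → ∀ {b} u v →
  (1ℚ - p u) + (1ℚ - p v) ≤ ℕtoℚ (mismatch u v) → 0ℚ < p b → b ≡ u ⊎ b ≡ v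
support-of-tight-complements {p = p} dist u v tight 0<pb with u ≟ v
... | yes refl = inj₁ (support-single dist
                   (-≤0⇒≤ (≤-trans (≤-+-nonneg (≤⇒0≤- (entry-≤-1 dist u))) tight)) 0<pb)
... | no u≢v   = support-pair dist u≢v (-≤0⇒≤ (+-cancelˡ-≤ 1ℚ
                   (subst₂ _≤_ (complements-sum (p u) (p v)) (sym (+-identityʳ 1ℚ)) tight))) 0<pb

sumℚ-same : ∀ {q} (c : Fin q) → sumℚ (λ a → same a c) ≡ 1ℚ
sumℚ-same {q} c = trans (sumℚ-without c _)
  (trans (cong₂ _+_ (same-refl c) (trans (sumℚ-cong vanishes) (sumℚ-zero {q}))) (+-identityʳ 1ℚ))
  where
  vanishes : ∀ a → without c (λ a → same a c) a ≡ 0ℚ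
  vanishes a with a ≟ c
  ... | yes _   = refl
  ... | no _    = refl

fixedMismatch : ∀ {q} → Maybe (Fin q) → Fin q → ℕ
fixedMismatch (just c) b = mismatch c b
fixedMismatch nothing  b = 0

freeMismatch : ∀ {q} → Maybe (Fin q) → Fin q → Fin q → ℕ
freeMismatch (just _) a b = 0
freeMismatch nothing  a b = mismatch a b

fixedDist : ∀ {q n} → State q n → Str q n → ℕ
fixedDist F u = sum (λ j → fixedMismatch (F j) (u j))

freeDist : ∀ {q n} → State q n → Str q n → Str q n → ℕ
freeDist F u v = sum (λ j → freeMismatch (F j) (u j) (v j))

freeDist-sym : ∀ {q n} (F : State q n) u v → freeDist F u v ≡ freeDist F v u
freeDist-sym F u v = sum-cong-≗ λ j → symmetric (F j) (u j) (v j)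
  where
  symmetric : ∀ {q} (m : Maybe (Fin q)) a b → freeMismatch m a b ≡ freeMismatch m b a
  symmetric (just _) a b = refl
  symmetric nothing  a b = mismatch-sym a b

charged : ∀ {q n} → State q n → Str q n → Str q n → Fin n → ℕ
charged F s t j = fixedMismatch (F j) (s j) ℕ.+ fixedMismatch (F j) (t j) ℕ.+ freeMismatch (F j) (s j) (t j)

sum-charged : ∀ {q n} (F : State q n) s t → sum (charged F s t) ≡ fixedDist F s ℕ.+ fixedDist F t ℕ.+ freeDist F s t
sum-charged F s t = trans (∑-distrib-+ (λ j → fixedMismatch (F j) (s j) ℕ.+ fixedMismatch (F j) (t j)) _)
                          (cong (ℕ._+ freeDist F s t) (∑-distrib-+ (λ j → fixedMismatch (F j) (s j)) _))

fixedFlag : ∀ {A : Set} → Maybe A → ℕ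
fixedFlag (just _) = 1
fixedFlag nothing  = 0

fixedCount : ∀ {A : Set} {k} → (Fin k → Maybe A) → ℕ
fixedCount F = sum (λ j → fixedFlag (F j))

fixedCount-≤ : ∀ {A : Set} {k} (F : Fin k → Maybe A) → fixedCount F ℕ.≤ k
fixedCount-≤ {k = zero}  F = ℕ.z≤n
fixedCount-≤ {k = suc k} F with F zero
... | just _  = ℕ.s≤s (fixedCount-≤ (λ j → F (suc j)))
... | nothing = ℕP.m≤n⇒m≤1+n (fixedCount-≤ (λ j → F (suc j)))

free⇒fixedCount-< : ∀ {A : Set} {k} (F : Fin k → Maybe A) {j} → F j ≡ nothing → fixedCount F ℕ.< k
free⇒fixedCount-< {k = suc k} F {zero} Fj rewrite Fj = ℕ.s≤s (fixedCount-≤ (λ j → F (suc j)))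
free⇒fixedCount-< {k = suc k} F {suc j} Fj with F zero
... | just _  = ℕ.s≤s (free⇒fixedCount-< (λ j → F (suc j)) Fj)
... | nothing = ℕP.m≤n⇒m≤1+n (free⇒fixedCount-< (λ j → F (suc j)) Fj)

free-position : ∀ {A : Set} {k} (F : Fin k → Maybe A) → fixedCount F ℕ.< k → Σ (Fin k) λ j → F j ≡ nothing
free-position {k = suc k} F count<k with F zero in F₀
... | nothing = zero , F₀
... | just _  = let j , Fj = free-position (λ j → F (suc j)) (ℕP.≤-pred count<k) in suc j , Fj

read-off : ∀ {A : Set} {k} (F : Fin k → Maybe A) → fixedCount F ≡ k → Σ (Fin k → A) λ t → ∀ j → F j ≡ just (t j)
read-off F count≡k = (λ j → proj₁ (letter j)) , λ j → proj₂ (letter j)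
  where
  letter : ∀ j → Σ _ λ c → F j ≡ just c
  letter j with F j in Fj
  ... | just c  = c , refl
  ... | nothing = ⊥-elim (ℕP.<-irrefl count≡k (free⇒fixedCount-< F Fj))

-- Facts about a feasible point (x, d) of the LP at state F.  The
-- constraint for a string u reads  Σ_j (1 - x_{u[j],j}) ≤ d; we call
-- 1 - x_{u[j],j} the deficit of u at position j.
module _ {q n} {s t : Str q n} {F : State q n} {x : LPVars q n} {d : ℚ}
         (feasible : Feasible s t F x d) where

  column-distribution : ∀ j → IsDistribution (λ a → x a j)
  column-distribution j = let (bounds , columns , _) = feasible in (λ a → proj₁ (bounds a j)) , columns j

  fixed-one : ∀ {a j} → F j ≡ just a → x a j ≡ 1ℚ
  fixed-one {a} {j} = let (_ , _ , _ , _ , is-one , _) = feasible in is-one a j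

  fixed-zero : ∀ {a b j} → F j ≡ just b → a ≢ b → x a j ≡ 0ℚ
  fixed-zero {a} {b} {j} = let (_ , _ , _ , _ , _ , is-zero) = feasible in is-zero a b j

  swap-feasible : Feasible t s F x d
  swap-feasible = let (bounds , columns , cons-s , cons-t , is-one , is-zero) = feasible
                  in bounds , columns , cons-t , cons-s , is-one , is-zero

  deficits-≤ : sumℚ (λ j → 1ℚ - x (s j) j) ≤ d
  deficits-≤ = let (_ , _ , cons-s , _) = feasible
               in subst (_≤ d) (sym (sumℚ-complement (λ j → x (s j) j))) cons-s

  fixedMismatch-≤-deficit : ∀ (u : Str q n) j → ℕtoℚ (fixedMismatch (F j) (u j)) ≤ 1ℚ - x (u j) j
  fixedMismatch-≤-deficit u j with F j in Fj
  ... | nothing = ≤⇒0≤- (entry-≤-1 (column-distribution j) (u j))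
  ... | just c  with c ≟ u j
  ...   | yes refl = ≤-reflexive (trans (sym (+-inverseʳ 1ℚ)) (cong (λ z → 1ℚ - z) (sym (fixed-one Fj))))
  ...   | no c≢uj  = ≤-reflexive (cong (λ z → 1ℚ - z) (sym (fixed-zero Fj (λ uj≡c → c≢uj (sym uj≡c)))))

  charged-≤-deficits : ∀ j → ℕtoℚ (charged F s t j) ≤ (1ℚ - x (s j) j) + (1ℚ - x (t j) j)
  charged-≤-deficits j with F j in Fj
  ... | nothing = mismatch-≤-complements (column-distribution j) (s j) (t j)
  ... | just c  = subst (_≤ (1ℚ - x (s j) j) + (1ℚ - x (t j) j)) (sym split)
                    (+-mono-≤ (subst (λ m → ℕtoℚ (fixedMismatch m (s j)) ≤ _) Fj (fixedMismatch-≤-deficit s j))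
                              (subst (λ m → ℕtoℚ (fixedMismatch m (t j)) ≤ _) Fj (fixedMismatch-≤-deficit t j)))
    where
    split : ℕtoℚ (mismatch c (s j) ℕ.+ mismatch c (t j) ℕ.+ 0) ≡ ℕtoℚ (mismatch c (s j)) + ℕtoℚ (mismatch c (t j))
    split = trans (cong ℕtoℚ (ℕP.+-identityʳ (mismatch c (s j) ℕ.+ mismatch c (t j))))
                  (ℕtoℚ-+ (mismatch c (s j)) (mismatch c (t j)))

swap-optimal : ∀ {q n} {s t : Str q n} {F x d} → LPOptimal s t F x d → LPOptimal t s F x d
swap-optimal (feasible , minimal) = swap-feasible feasible , λ x′ d′ feasible′ → minimal x′ d′ (swap-feasible feasible′)

mixLetter : ∀ {q} → ℚ → Maybe (Fin q) → Fin q → Fin q → Fin q → ℚ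
mixLetter α (just c) u v a = same a c
mixLetter α nothing  u v a = α * same a u + (1ℚ - α) * same a v

mixture : ∀ {q n} → ℚ → State q n → Str q n → Str q n → LPVars q n
mixture α F u v a j = mixLetter α (F j) (u j) (v j) a

mixLetter-sum : ∀ {q} α (m : Maybe (Fin q)) u v → sumℚ (λ a → mixLetter α m u v a) ≡ 1ℚ
mixLetter-sum α (just c) u v = sumℚ-same c
mixLetter-sum α nothing  u v = begin
  sumℚ (λ a → α * same a u + (1ℚ - α) * same a v)
    ≡⟨ sumℚ-+ (λ a → α * same a u) (λ a → (1ℚ - α) * same a v) ⟩
  sumℚ (λ a → α * same a u) + sumℚ (λ a → (1ℚ - α) * same a v)
    ≡⟨ cong₂ _+_ (sumℚ-*ˡ α (λ a → same a u)) (sumℚ-*ˡ (1ℚ - α) (λ a → same a v)) ⟩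
  α * sumℚ (λ a → same a u) + (1ℚ - α) * sumℚ (λ a → same a v)
    ≡⟨ cong₂ (λ y z → α * y + (1ℚ - α) * z) (sumℚ-same u) (sumℚ-same v) ⟩
  α * 1ℚ + (1ℚ - α) * 1ℚ
    ≡⟨ solve 1 (λ α → α :* con 1ℚ :+ (con 1ℚ :- α) :* con 1ℚ := con 1ℚ) refl α ⟩
  1ℚ ∎
  where open ≡-Reasoning

mixLetter-bounds : ∀ {q} {α} → 0ℚ ≤ α → α ≤ 1ℚ → ∀ (m : Maybe (Fin q)) u v a →
                   0ℚ ≤ mixLetter α m u v a × mixLetter α m u v a ≤ 1ℚ
mixLetter-bounds 0≤α α≤1 (just c) u v a = same-bounds a c
mixLetter-bounds {α = α} 0≤α α≤1 nothing u v a =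
    +-mono-≤ (weighted-nonneg 0≤α (proj₁ (same-bounds a u))) (weighted-nonneg 0≤1-α (proj₁ (same-bounds a v)))
  , ≤-trans (+-mono-≤ (weighted-≤ 0≤α (proj₂ (same-bounds a u))) (weighted-≤ 0≤1-α (proj₂ (same-bounds a v))))
            (≤-reflexive (solve 1 (λ α → α :* con 1ℚ :+ (con 1ℚ :- α) :* con 1ℚ := con 1ℚ) refl α))
  where
  0≤1-α : 0ℚ ≤ 1ℚ - α
  0≤1-α = ≤⇒0≤- α≤1
  weighted-≤ : ∀ {w b c} → 0ℚ ≤ w → b ≤ c → w * b ≤ w * c
  weighted-≤ {w} 0≤w b≤c = *-monoˡ-≤-nonNeg w {{nonNegative 0≤w}} b≤c
  weighted-nonneg : ∀ {w b} → 0ℚ ≤ w → 0ℚ ≤ b → 0ℚ ≤ w * b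
  weighted-nonneg {w} {b} 0≤w 0≤b = subst (_≤ w * b) (*-zeroʳ w) (weighted-≤ 0≤w 0≤b)

mixLetter-deficitˡ : ∀ {q} α (m : Maybe (Fin q)) u v →
  1ℚ - mixLetter α m u v u ≡ ℕtoℚ (fixedMismatch m u) + (1ℚ - α) * ℕtoℚ (freeMismatch m u v)
mixLetter-deficitʳ : ∀ {q} α (m : Maybe (Fin q)) u v →
  1ℚ - mixLetter α m u v v ≡ ℕtoℚ (fixedMismatch m v) + α * ℕtoℚ (freeMismatch m u v)

mixLetter-deficitˡ α (just c) u v = begin
  1ℚ - same u c                  ≡⟨ one-minus-same u c ⟩
  ℕtoℚ (mismatch u c)            ≡⟨ cong ℕtoℚ (mismatch-sym u c) ⟩
  ℕtoℚ (mismatch c u)            ≡⟨ +-identityʳ _ ⟨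
  ℕtoℚ (mismatch c u) + 0ℚ       ≡⟨ cong (ℕtoℚ (mismatch c u) +_) (*-zeroʳ (1ℚ - α)) ⟨
  ℕtoℚ (mismatch c u) + (1ℚ - α) * 0ℚ ∎
  where open ≡-Reasoning
mixLetter-deficitˡ α nothing u v = begin
  1ℚ - (α * same u u + (1ℚ - α) * same u v)  ≡⟨ cong (λ i → 1ℚ - (α * i + (1ℚ - α) * same u v)) (same-refl u) ⟩
  1ℚ - (α * 1ℚ + (1ℚ - α) * same u v)        ≡⟨ solve 2 (λ α i → con 1ℚ :- (α :* con 1ℚ :+ (con 1ℚ :- α) :* i)
                                                             := con 0ℚ :+ (con 1ℚ :- α) :* (con 1ℚ :- i)) refl α (same u v) ⟩
  0ℚ + (1ℚ - α) * (1ℚ - same u v)            ≡⟨ cong (λ z → 0ℚ + (1ℚ - α) * z) (one-minus-same u v) ⟩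
  0ℚ + (1ℚ - α) * ℕtoℚ (mismatch u v)        ∎
  where open ≡-Reasoning

mixLetter-deficitʳ α (just c) u v = begin
  1ℚ - same v c                  ≡⟨ one-minus-same v c ⟩
  ℕtoℚ (mismatch v c)            ≡⟨ cong ℕtoℚ (mismatch-sym v c) ⟩
  ℕtoℚ (mismatch c v)            ≡⟨ +-identityʳ _ ⟨
  ℕtoℚ (mismatch c v) + 0ℚ       ≡⟨ cong (ℕtoℚ (mismatch c v) +_) (*-zeroʳ α) ⟨
  ℕtoℚ (mismatch c v) + α * 0ℚ   ∎
  where open ≡-Reasoning
mixLetter-deficitʳ α nothing u v = begin
  1ℚ - (α * same v u + (1ℚ - α) * same v v)  ≡⟨ cong₂ (λ i j → 1ℚ - (α * i + (1ℚ - α) * j)) (same-sym v u) (same-refl v) ⟩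
  1ℚ - (α * same u v + (1ℚ - α) * 1ℚ)        ≡⟨ solve 2 (λ α i → con 1ℚ :- (α :* i :+ (con 1ℚ :- α) :* con 1ℚ)
                                                             := con 0ℚ :+ α :* (con 1ℚ :- i)) refl α (same u v) ⟩
  0ℚ + α * (1ℚ - same u v)                   ≡⟨ cong (λ z → 0ℚ + α * z) (one-minus-same u v) ⟩
  0ℚ + α * ℕtoℚ (mismatch u v)               ∎
  where open ≡-Reasoning

constraint-value : ∀ {n} (f : Fin n → ℚ) (A B : Fin n → ℕ) c →
  (∀ j → 1ℚ - f j ≡ ℕtoℚ (A j) + c * ℕtoℚ (B j)) → ℕtoℚ n - sumℚ f ≡ ℕtoℚ (sum A) + c * ℕtoℚ (sum B)
constraint-value {n} f A B c deficit = begin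
  ℕtoℚ n - sumℚ f                          ≡⟨ sumℚ-complement f ⟨
  sumℚ (λ j → 1ℚ - f j)                    ≡⟨ sumℚ-cong deficit ⟩
  sumℚ (λ j → A′ j + c * B′ j)             ≡⟨ sumℚ-+ A′ (λ j → c * B′ j) ⟩
  sumℚ A′ + sumℚ (λ j → c * B′ j)          ≡⟨ cong (sumℚ A′ +_) (sumℚ-*ˡ c B′) ⟩
  sumℚ A′ + c * sumℚ B′                    ≡⟨ cong₂ (λ y z → y + c * z) (sumℚ-ℕtoℚ A) (sumℚ-ℕtoℚ B) ⟩
  ℕtoℚ (sum A) + c * ℕtoℚ (sum B)          ∎
  where
  open ≡-Reasoning
  A′ B′ : Fin n → ℚ
  A′ j = ℕtoℚ (A j)
  B′ j = ℕtoℚ (B j)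

mixture-feasible : ∀ {q n} {s t : Str q n} {F : State q n} {α d} → 0ℚ ≤ α → α ≤ 1ℚ →
  ℕtoℚ (fixedDist F s) + (1ℚ - α) * ℕtoℚ (freeDist F s t) ≤ d →
  ℕtoℚ (fixedDist F t) + α * ℕtoℚ (freeDist F s t) ≤ d →
  Feasible s t F (mixture α F s t) d
mixture-feasible {s = s} {t} {F} {α} 0≤α α≤1 value-s≤d value-t≤d =
    (λ a j → mixLetter-bounds 0≤α α≤1 (F j) (s j) (t j) a)
  , (λ j → mixLetter-sum α (F j) (s j) (t j))
  , subst (_≤ _) (sym (constraint-value _ _ _ (1ℚ - α) (λ j → mixLetter-deficitˡ α (F j) (s j) (t j)))) value-s≤d
  , subst (_≤ _) (sym (constraint-value _ _ _ α (λ j → mixLetter-deficitʳ α (F j) (s j) (t j)))) value-t≤d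
  , (λ a j Fj → subst (λ m → mixLetter α m (s j) (t j) a ≡ 1ℚ) (sym Fj) (same-refl a))
  , (λ a b j Fj a≢b → subst (λ m → mixLetter α m (s j) (t j) a ≡ 0ℚ) (sym Fj) (same-≢ a≢b))

equalising-weight : ∀ {M₁ M₂ W P h} → P + M₂ ≡ M₁ + W → (W + W) * h ≡ 1ℚ →
                    M₂ + (P * h) * W ≡ M₁ + (1ℚ - P * h) * W
equalising-weight {M₁} {M₂} {W} {P} {h} P+M₂≡M₁+W 2W·h≡1 = sym (begin
  M₁ + (1ℚ - P * h) * W
    ≡⟨ solve 5 (λ M₁ M₂ W P h → M₁ :+ (con 1ℚ :- P :* h) :* W
                 := (M₂ :+ (P :* h) :* W) :+ ((M₁ :+ W) :- (P :+ M₂)) :+ P :* (con 1ℚ :- (W :+ W) :* h))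
               refl M₁ M₂ W P h ⟩
  (M₂ + (P * h) * W) + ((M₁ + W) - (P + M₂)) + P * (1ℚ - (W + W) * h)
    ≡⟨ cong₂ (λ y z → (M₂ + (P * h) * W) + ((M₁ + W) - y) + P * (1ℚ - z)) P+M₂≡M₁+W 2W·h≡1 ⟩
  (M₂ + (P * h) * W) + ((M₁ + W) - (M₁ + W)) + P * (1ℚ - 1ℚ)
    ≡⟨ cong (λ y → (M₂ + (P * h) * W) + y + P * (1ℚ - 1ℚ)) (+-inverseʳ (M₁ + W)) ⟩
  (M₂ + (P * h) * W) + 0ℚ + P * 0ℚ
    ≡⟨ solve 2 (λ X P → X :+ con 0ℚ :+ P :* con 0ℚ := X) refl (M₂ + (P * h) * W) P ⟩
  M₂ + (P * h) * W ∎)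
  where open ≡-Reasoning

equalised-value-twice : ∀ {M₁ M₂ W α} → M₂ + α * W ≡ M₁ + (1ℚ - α) * W →
                        (M₁ + (1ℚ - α) * W) + (M₁ + (1ℚ - α) * W) ≡ (M₁ + M₂) + W
equalised-value-twice {M₁} {M₂} {W} {α} equalised =
  trans (cong ((M₁ + (1ℚ - α) * W) +_) (sym equalised))
        (solve 4 (λ M₁ M₂ W α → (M₁ :+ (con 1ℚ :- α) :* W) :+ (M₂ :+ α :* W) := (M₁ :+ M₂) :+ W) refl M₁ M₂ W α)

-- If m₁ and m₂ differ by less than U, the weight α = (m₁ + U - m₂)/2U
-- lies in [0, 1] and equalises the two constraint values of the mixture.
balancing-weight : ∀ m₁ m₂ U → m₁ ℕ.< m₂ ℕ.+ U → m₂ ℕ.< m₁ ℕ.+ U →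
  Σ ℚ λ α → 0ℚ ≤ α × α ≤ 1ℚ × ℕtoℚ m₂ + α * ℕtoℚ U ≡ ℕtoℚ m₁ + (1ℚ - α) * ℕtoℚ U
balancing-weight m₁ m₂ zero m₁<m₂ m₂<m₁
  rewrite ℕP.+-identityʳ m₁ | ℕP.+-identityʳ m₂ = ⊥-elim (ℕP.<-asym m₁<m₂ m₂<m₁)
balancing-weight m₁ m₂ U@(suc _) m₁<m₂+U m₂<m₁+U = α , 0≤α , α≤1 , balanced
  where
  p : ℕ
  p = m₁ ℕ.+ U ℕ.∸ m₂
  p+m₂≡m₁+U : p ℕ.+ m₂ ≡ m₁ ℕ.+ U
  p+m₂≡m₁+U = ℕP.m∸n+n≡m (ℕP.<⇒≤ m₂<m₁+U)
  p≤U+U : p ℕ.≤ U ℕ.+ U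
  p≤U+U = ℕP.+-cancelʳ-≤ m₂ p (U ℕ.+ U) (begin
    p ℕ.+ m₂          ≡⟨ p+m₂≡m₁+U ⟩
    m₁ ℕ.+ U          ≤⟨ ℕP.+-monoˡ-≤ U (ℕP.<⇒≤ m₁<m₂+U) ⟩
    m₂ ℕ.+ U ℕ.+ U    ≡⟨ ℕP.+-comm (m₂ ℕ.+ U) U ⟩
    U ℕ.+ (m₂ ℕ.+ U)  ≡⟨ cong (U ℕ.+_) (ℕP.+-comm m₂ U) ⟩
    U ℕ.+ (U ℕ.+ m₂)  ≡⟨ ℕP.+-assoc U U m₂ ⟨
    U ℕ.+ U ℕ.+ m₂    ∎)
    where open ℕP.≤-Reasoning
  D : ℚ
  D = ℕtoℚ (U ℕ.+ U)
  instance
    D-positive : Positive D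
    D-positive = normalize-pos (U ℕ.+ U) 1
    D-nonZero : NonZero D
    D-nonZero = pos⇒nonZero D
  0≤1/D : 0ℚ ≤ 1/ D
  0≤1/D = <⇒≤ (positive⁻¹ (1/ D) {{1/pos⇒pos D}})
  α : ℚ
  α = ℕtoℚ p * 1/ D
  0≤α : 0ℚ ≤ α
  0≤α = subst (_≤ α) (*-zeroˡ (1/ D)) (*-monoʳ-≤-nonNeg (1/ D) {{nonNegative 0≤1/D}} (ℕtoℚ-nonneg p))
  α≤1 : α ≤ 1ℚ
  α≤1 = ≤-trans (*-monoʳ-≤-nonNeg (1/ D) {{nonNegative 0≤1/D}} (ℕtoℚ-mono p≤U+U)) (≤-reflexive (*-inverseʳ D))
  balanced : ℕtoℚ m₂ + α * ℕtoℚ U ≡ ℕtoℚ m₁ + (1ℚ - α) * ℕtoℚ U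
  balanced = equalising-weight {ℕtoℚ m₁} {ℕtoℚ m₂} {ℕtoℚ U} {ℕtoℚ p} {1/ D}
    (trans (sym (ℕtoℚ-+ p m₂)) (trans (cong ℕtoℚ p+m₂≡m₁+U) (ℕtoℚ-+ m₁ U)))
    (trans (cong (_* 1/ D) (sym (ℕtoℚ-+ U U))) (*-inverseʳ D))

-- The shape of an optimum (x, d) of the LP at F at a free position k,
-- obtained by comparing d with the value of a suitable mixture.
module _ {q n} {s t : Str q n} {F : State q n} {x : LPVars q n} {d : ℚ}
         (optimal : LPOptimal s t F x d) {k : Fin n} (k-free : F k ≡ nothing) where

  private
    feasible = proj₁ optimal
    minimal  = proj₂ optimal

  optimum-copies-t : fixedDist F s ℕ.+ freeDist F s t ℕ.≤ fixedDist F t → ∀ {b} → 0ℚ < x b k → b ≡ t k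
  optimum-copies-t m₁+U≤m₂ 0<xbk =
    support-single (column-distribution feasible k) (-≤0⇒≤ deficit-at-k) 0<xbk
    where
    m₁ m₂ U : ℚ
    m₁ = ℕtoℚ (fixedDist F s)
    m₂ = ℕtoℚ (fixedDist F t)
    U  = ℕtoℚ (freeDist F s t)
    -- the mixture of weight 0 is t on the free positions and has value m₂
    d≤m₂ : d ≤ m₂
    d≤m₂ = minimal (mixture 0ℚ F s t) m₂ (mixture-feasible ≤-refl 0≤1
      (subst (_≤ m₂) (trans (ℕtoℚ-+ (fixedDist F s) _) (cong (m₁ +_) (sym (*-identityˡ U)))) (ℕtoℚ-mono m₁+U≤m₂))
      (≤-reflexive (trans (cong (m₂ +_) (*-zeroˡ U)) (+-identityʳ m₂))))
    deficits : sumℚ (λ j → 1ℚ - x (t j) j) ≤ sumℚ (λ j → ℕtoℚ (fixedMismatch (F j) (t j)))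
    deficits = ≤-trans (deficits-≤ (swap-feasible feasible))
                       (≤-trans d≤m₂ (≤-reflexive (sym (sumℚ-ℕtoℚ (λ j → fixedMismatch (F j) (t j))))))
    deficit-at-k : 1ℚ - x (t k) k ≤ 0ℚ
    deficit-at-k = subst (λ m → 1ℚ - x (t k) k ≤ ℕtoℚ (fixedMismatch m (t k))) k-free
      (pointwise-≤-of-sum _ _ (fixedMismatch-≤-deficit feasible t) deficits k)

  optimum-within-s-t : fixedDist F s ℕ.< fixedDist F t ℕ.+ freeDist F s t →
                       fixedDist F t ℕ.< fixedDist F s ℕ.+ freeDist F s t →
                       ∀ {b} → 0ℚ < x b k → b ≡ s k ⊎ b ≡ t k
  optimum-within-s-t m₁<m₂+U m₂<m₁+U 0<xbk =
    support-of-tight-complements (column-distribution feasible k) (s k) (t k) deficits-at-k 0<xbk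
    where
    m₁ m₂ U : ℚ
    m₁ = ℕtoℚ (fixedDist F s)
    m₂ = ℕtoℚ (fixedDist F t)
    U  = ℕtoℚ (freeDist F s t)
    weight = balancing-weight (fixedDist F s) (fixedDist F t) (freeDist F s t) m₁<m₂+U m₂<m₁+U
    α : ℚ
    α = proj₁ weight
    equalised : m₂ + α * U ≡ m₁ + (1ℚ - α) * U
    equalised = proj₂ (proj₂ (proj₂ weight))
    D : ℚ
    D = m₁ + (1ℚ - α) * U
    d≤D : d ≤ D
    d≤D = minimal (mixture α F s t) D
                  (mixture-feasible (proj₁ (proj₂ weight)) (proj₁ (proj₂ (proj₂ weight))) ≤-refl (≤-reflexive equalised))
    D+D : D + D ≡ sumℚ (λ j → ℕtoℚ (charged F s t j))
    D+D = begin
      D + D                      ≡⟨ equalised-value-twice {m₁} {m₂} {U} {α} equalised ⟩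
      (m₁ + m₂) + U              ≡⟨ cong (_+ U) (ℕtoℚ-+ (fixedDist F s) (fixedDist F t)) ⟨
      ℕtoℚ (fixedDist F s ℕ.+ fixedDist F t) + U
                                 ≡⟨ ℕtoℚ-+ (fixedDist F s ℕ.+ fixedDist F t) (freeDist F s t) ⟨
      ℕtoℚ (fixedDist F s ℕ.+ fixedDist F t ℕ.+ freeDist F s t)
                                 ≡⟨ cong ℕtoℚ (sum-charged F s t) ⟨
      ℕtoℚ (sum (charged F s t)) ≡⟨ sumℚ-ℕtoℚ (charged F s t) ⟨
      sumℚ (λ j → ℕtoℚ (charged F s t j)) ∎
      where open ≡-Reasoning
    deficits : sumℚ (λ j → (1ℚ - x (s j) j) + (1ℚ - x (t j) j)) ≤ sumℚ (λ j → ℕtoℚ (charged F s t j))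
    deficits = begin
      sumℚ (λ j → (1ℚ - x (s j) j) + (1ℚ - x (t j) j))      ≡⟨ sumℚ-+ (λ j → 1ℚ - x (s j) j) (λ j → 1ℚ - x (t j) j) ⟩
      sumℚ (λ j → 1ℚ - x (s j) j) + sumℚ (λ j → 1ℚ - x (t j) j)
                                   ≤⟨ +-mono-≤ (deficits-≤ feasible) (deficits-≤ (swap-feasible feasible)) ⟩
      d + d                        ≤⟨ +-mono-≤ d≤D d≤D ⟩
      D + D                        ≡⟨ D+D ⟩
      sumℚ (λ j → ℕtoℚ (charged F s t j)) ∎
      where open ≤-Reasoning
    deficits-at-k : (1ℚ - x (s k) k) + (1ℚ - x (t k) k) ≤ ℕtoℚ (mismatch (s k) (t k))
    deficits-at-k = subst (λ m → _ ≤ ℕtoℚ (fixedMismatch m (s k) ℕ.+ fixedMismatch m (t k) ℕ.+ freeMismatch m (s k) (t k)))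
                          k-free (pointwise-≤-of-sum _ _ (charged-≤-deficits feasible) deficits k)

-- The variable chosen by an iteration of Algorithm A has positive value,
-- as long as some position is still free: a free column is a distribution,
-- hence has a positive entry, and none of its variables lies in V₁.
chosen-positive : ∀ {q n} {s t : Str q n} {F : State q n} {x d b k} → Feasible s t F x d →
                  fixedCount F ℕ.< n → (∀ a j → ¬ InV₁ F a j → x a j ≤ x b k) → 0ℚ < x b k
chosen-positive {F = F} {x} feasible count<n maximal =
  let j , Fj = free-position F count<n
      a , 0<xaj = positive-entry (λ a → x a j)
                    (subst (0ℚ <_) (sym (proj₂ (column-distribution feasible j))) (positive⁻¹ 1ℚ))
  in <-≤-trans 0<xaj (maximal a j (λ Fj≡a → nothing≢just (trans (sym Fj) Fj≡a)))
  where
  nothing≢just : ∀ {A : Set} {a : A} → nothing ≢ just a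
  nothing≢just ()

-- A positive variable outside V₁ sits at a free position, since the
-- variables of a fixed position other than the fixed one are 0.
chosen-free : ∀ {q n} {s t : Str q n} {F : State q n} {x d b k} → Feasible s t F x d →
              ¬ InV₁ F b k → 0ℚ < x b k → F k ≡ nothing
chosen-free {F = F} {b = b} {k} feasible b∉V₁ 0<xbk with F k in Fk
... | nothing = refl
... | just c with b ≟ c
...   | yes refl = ⊥-elim (b∉V₁ refl)
...   | no b≢c   = ⊥-elim (positive⇒≰0 0<xbk (≤-reflexive (fixed-zero feasible Fk b≢c)))

-- Slack F u v: u can absorb one more mismatch, i.e. fixing a free
-- disagreement of u and v to the letter of v keeps the state balanced.
Slack : ∀ {q n} → State q n → Str q n → Str q n → Set
Slack F u v = 0 ℕ.< freeDist F u v → fixedDist F u ℕ.< fixedDist F v ℕ.+ freeDist F u v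

dominated⇒slack : ∀ {q n} {F : State q n} {u v} → fixedDist F u ℕ.+ freeDist F u v ℕ.≤ fixedDist F v → Slack F u v
dominated⇒slack {F = F} {u} {v} dominated 0<U =
  ℕP.<-≤-trans (ℕP.m<m+n (fixedDist F u) 0<U) (ℕP.≤-trans dominated (ℕP.m≤m+n (fixedDist F v) (freeDist F u v)))

chosen-letter : ∀ {q n} {s t : Str q n} {F : State q n} {x d b k} → LPOptimal s t F x d →
                F k ≡ nothing → 0ℚ < x b k → (b ≡ t k × Slack F s t) ⊎ (b ≡ s k × Slack F t s)
chosen-letter {s = s} {t} {F} {b = b} {k} optimal k-free 0<xbk
  with fixedDist F s ℕ.+ freeDist F s t ℕ.≤? fixedDist F t
... | yes s-dominated = inj₁ (optimum-copies-t optimal k-free s-dominated 0<xbk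
                             , dominated⇒slack {F = F} {s} {t} s-dominated)
... | no s-undominated with fixedDist F t ℕ.+ freeDist F t s ℕ.≤? fixedDist F s
...   | yes t-dominated = inj₂ (optimum-copies-t (swap-optimal optimal) k-free t-dominated 0<xbk
                               , dominated⇒slack {F = F} {t} {s} t-dominated)
...   | no t-undominated = letter (optimum-within-s-t optimal k-free m₁<m₂+U m₂<m₁+U 0<xbk)
  where
  m₁<m₂+U : fixedDist F s ℕ.< fixedDist F t ℕ.+ freeDist F s t
  m₁<m₂+U = subst (λ U → fixedDist F s ℕ.< fixedDist F t ℕ.+ U) (freeDist-sym F t s) (ℕP.≰⇒> t-undominated)
  m₂<m₁+U : fixedDist F t ℕ.< fixedDist F s ℕ.+ freeDist F s t
  m₂<m₁+U = ℕP.≰⇒> s-undominated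
  letter : b ≡ s k ⊎ b ≡ t k → (b ≡ t k × Slack F s t) ⊎ (b ≡ s k × Slack F t s)
  letter (inj₁ b≡s) = inj₂ (b≡s , λ _ → subst (λ U → fixedDist F t ℕ.< fixedDist F s ℕ.+ U)
                                                (freeDist-sym F s t) m₂<m₁+U)
  letter (inj₂ b≡t) = inj₁ (b≡t , λ _ → m₁<m₂+U)

Balanced : ℕ → ℕ → ℕ → Set
Balanced m₁ m₂ U = m₁ ℕ.≤ m₂ ℕ.+ U ℕ.+ 1 × m₂ ℕ.≤ m₁ ℕ.+ U ℕ.+ 1

balanced-resp : ∀ {m₁ m₂ U m₁′ m₂′ U′} → m₁ ≡ m₁′ → m₂ ≡ m₂′ → U ≡ U′ →
                Balanced m₁ m₂ U → Balanced m₁′ m₂′ U′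
balanced-resp refl refl refl balanced = balanced

balanced-shift : ∀ {m₁ m₂ U} → m₁ ℕ.< m₂ ℕ.+ suc U → Balanced m₁ m₂ (suc U) → Balanced (suc m₁) m₂ U
balanced-shift {m₁} {m₂} {U} m₁<m₂+1+U (_ , m₂≤m₁+1+U+1) =
    subst (suc m₁ ℕ.≤_) (ℕP.+-comm 1 (m₂ ℕ.+ U)) (subst (m₁ ℕ.<_) (ℕP.+-suc m₂ U) m₁<m₂+1+U)
  , subst (λ z → m₂ ℕ.≤ z ℕ.+ 1) (ℕP.+-suc m₁ U) m₂≤m₁+1+U+1

BalancedAt : ∀ {q n} → State q n → Str q n → Str q n → Set
BalancedAt F u v = Balanced (fixedDist F u) (fixedDist F v) (freeDist F u v)

balancedAt-sym : ∀ {q n} {F : State q n} {u v} → BalancedAt F u v → BalancedAt F v u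
balancedAt-sym {F = F} {u} {v} (u≤ , v≤) =
  subst (λ U → Balanced (fixedDist F v) (fixedDist F u) U) (freeDist-sym F u v) (v≤ , u≤)

module Fixing {q n} {F F′ : State q n} {k : Fin n} {b : Fin q}
              (k-free : F k ≡ nothing) (F′k : F′ k ≡ just b) (unchanged : ∀ j → j ≢ k → F′ j ≡ F j) where

  fixedCount-step : fixedCount F′ ≡ suc (fixedCount F)
  fixedCount-step =
    trans (sum-update k _ _ (λ j j≢k → cong fixedFlag (unchanged j j≢k)) (cong fixedFlag k-free))
          (trans (cong (fixedCount F ℕ.+_) (cong fixedFlag F′k)) (ℕP.+-comm (fixedCount F) 1))

  fixedDist-step : ∀ u → fixedDist F′ u ≡ fixedDist F u ℕ.+ mismatch b (u k)
  fixedDist-step u =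
    trans (sum-update k _ _ (λ j j≢k → cong (λ m → fixedMismatch m (u j)) (unchanged j j≢k))
                            (cong (λ m → fixedMismatch m (u k)) k-free))
          (cong (λ m → fixedDist F u ℕ.+ fixedMismatch m (u k)) F′k)

  freeDist-step : ∀ u v → freeDist F u v ≡ freeDist F′ u v ℕ.+ mismatch (u k) (v k)
  freeDist-step u v =
    trans (sum-update k _ _ (λ j j≢k → cong (λ m → freeMismatch m (u j) (v j)) (sym (unchanged j j≢k)))
                            (cong (λ m → freeMismatch m (u k) (v k)) F′k))
          (cong (λ m → freeDist F′ u v ℕ.+ freeMismatch m (u k) (v k)) k-free)

  private
    drop-zero : ∀ {a c z} → a ≡ c ℕ.+ z → z ≡ 0 → a ≡ c
    drop-zero {c = c} refl refl = ℕP.+-identityʳ c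

    drop-one : ∀ {a c z} → a ≡ c ℕ.+ z → z ≡ 1 → a ≡ suc c
    drop-one {c = c} refl refl = ℕP.+-comm c 1

  balanced-agree : ∀ u v → u k ≡ v k → b ≡ u k → BalancedAt F u v → BalancedAt F′ u v
  balanced-agree u v uk≡vk refl = balanced-resp
    (sym (drop-zero (fixedDist-step u) (mismatch-refl (u k))))
    (sym (drop-zero (fixedDist-step v) (trans (cong (mismatch (u k)) (sym uk≡vk)) (mismatch-refl (u k)))))
    (drop-zero (freeDist-step u v) (trans (cong (mismatch (u k)) (sym uk≡vk)) (mismatch-refl (u k))))

  -- If u and v disagree at k and b is the letter of v, the free
  -- disagreement becomes a fixed mismatch with u; slack keeps the balance.
  balanced-toward : ∀ u v → u k ≢ v k → b ≡ v k → Slack F u v → BalancedAt F u v → BalancedAt F′ u v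
  balanced-toward u v uk≢vk refl slack balanced =
    balanced-resp (sym fixedDist-u) (sym fixedDist-v) refl
      (balanced-shift (subst (λ U → fixedDist F u ℕ.< fixedDist F v ℕ.+ U) freeDist-uv (slack 0<U))
                      (balanced-resp refl refl freeDist-uv balanced))
    where
    freeDist-uv : freeDist F u v ≡ suc (freeDist F′ u v)
    freeDist-uv = drop-one (freeDist-step u v) (mismatch-≢ uk≢vk)
    fixedDist-u : fixedDist F′ u ≡ suc (fixedDist F u)
    fixedDist-u = drop-one (fixedDist-step u) (mismatch-≢ (λ vk≡uk → uk≢vk (sym vk≡uk)))
    fixedDist-v : fixedDist F′ v ≡ fixedDist F v
    fixedDist-v = drop-zero (fixedDist-step v) (mismatch-refl (v k))
    0<U : 0 ℕ.< freeDist F u v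
    0<U = subst (0 ℕ.<_) (sym freeDist-uv) (ℕ.s≤s ℕ.z≤n)

record Invariant {q n} (s₁ s₂ : Str q n) (i : ℕ) (F : State q n) : Set where
  field
    fixed-count : fixedCount F ≡ i
    follows     : ∀ j c → F j ≡ just c → c ≡ s₁ j ⊎ c ≡ s₂ j
    balanced    : BalancedAt F s₁ s₂

invariant-initial : ∀ {q n} (s₁ s₂ : Str q n) → Invariant s₁ s₂ 0 initial
invariant-initial {n = n} s₁ s₂ = record
  { fixed-count = sum-replicate-zero n
  ; follows     = λ j c ()
  ; balanced    = nothing-fixed , nothing-fixed
  }
  where
  nothing-fixed : sum {n} (λ _ → 0) ℕ.≤ sum {n} (λ _ → 0) ℕ.+ freeDist initial s₁ s₂ ℕ.+ 1
  nothing-fixed = ℕP.≤-trans (ℕP.m≤m+n _ (freeDist initial s₁ s₂)) (ℕP.m≤m+n _ 1)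

invariant-step : ∀ {q n} {s₁ s₂ : Str q n} {i F F′} → Invariant s₁ s₂ i F → i ℕ.< n →
                 Step s₁ s₂ F F′ → Invariant s₁ s₂ (suc i) F′
invariant-step {n = n} {s₁} {s₂} {i} {F} {F′} inv i<n
               (x , d , optimal , b , k , b∉V₁ , maximal , F′k , unchanged) = record
  { fixed-count = trans fixedCount-step (cong suc fixed-count)
  ; follows     = follows′
  ; balanced    = balanced′ choice
  }
  where
  open Invariant inv
  0<xbk = chosen-positive (proj₁ optimal) (subst (ℕ._< n) (sym fixed-count) i<n) maximal
  k-free = chosen-free (proj₁ optimal) b∉V₁ 0<xbk
  choice = chosen-letter optimal k-free 0<xbk
  open Fixing k-free F′k unchanged

  b-follows : b ≡ s₁ k ⊎ b ≡ s₂ k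
  b-follows with choice
  ... | inj₁ (b≡s₂ , _) = inj₂ b≡s₂
  ... | inj₂ (b≡s₁ , _) = inj₁ b≡s₁

  follows′ : ∀ j c → F′ j ≡ just c → c ≡ s₁ j ⊎ c ≡ s₂ j
  follows′ j c F′j with j ≟ k
  ... | yes refl = subst (λ a → a ≡ s₁ k ⊎ a ≡ s₂ k) (just-injective (trans (sym F′k) F′j)) b-follows
  ... | no j≢k   = follows j c (trans (sym (unchanged j j≢k)) F′j)

  balanced′ : (b ≡ s₂ k × Slack F s₁ s₂) ⊎ (b ≡ s₁ k × Slack F s₂ s₁) → BalancedAt F′ s₁ s₂
  balanced′ _ with s₁ k ≟ s₂ k
  balanced′ (inj₁ (b≡s₂ , _)) | yes agree = balanced-agree s₁ s₂ agree (trans b≡s₂ (sym agree)) balanced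
  balanced′ (inj₂ (b≡s₁ , _)) | yes agree = balanced-agree s₁ s₂ agree b≡s₁ balanced
  balanced′ (inj₁ (b≡s₂ , slack)) | no differ = balanced-toward s₁ s₂ differ b≡s₂ slack balanced
  balanced′ (inj₂ (b≡s₁ , slack)) | no differ =
    balancedAt-sym {F = F′} {s₂} {s₁}
      (balanced-toward s₂ s₁ (λ s₂≡s₁ → differ (sym s₂≡s₁)) b≡s₁ slack (balancedAt-sym {F = F} {s₁} {s₂} balanced))

invariant-run : ∀ {q n} {s₁ s₂ : Str q n} (run : ℕ → State q n) → IsRun s₁ s₂ run →
                ∀ i → i ℕ.≤ n → Invariant s₁ s₂ i (run i)
invariant-run {s₁ = s₁} {s₂} run (starts , steps) zero    _   =
  subst (Invariant s₁ s₂ 0) (sym starts) (invariant-initial s₁ s₂)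
invariant-run                run (starts , steps) (suc i) i<n =
  invariant-step (invariant-run run (starts , steps) i (ℕP.<⇒≤ i<n)) i<n (steps i i<n)

-- If a + b ≤ c + d and a, b differ by at most one, then max(a,b) ≤ max(c,d):
-- with M = max(c,d) we get a + a ≤ a + b + 1 ≤ 2M + 1, so a ≤ M.
max-≤-of-sum : ∀ {a b c d} → Balanced a b 0 → a ℕ.+ b ℕ.≤ c ℕ.+ d → a ℕ.⊔ b ℕ.≤ c ℕ.⊔ d
max-≤-of-sum {a} {b} {c} {d} (a≤b+1 , b≤a+1) a+b≤c+d =
  ℕP.⊔-lub (half a b a≤b+1 a+b≤c+d) (half b a b≤a+1 (subst (ℕ._≤ c ℕ.+ d) (ℕP.+-comm a b) a+b≤c+d))
  where
  M = c ℕ.⊔ d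
  c+d≤M+M : c ℕ.+ d ℕ.≤ M ℕ.+ M
  c+d≤M+M = ℕP.+-mono-≤ (ℕP.m≤m⊔n c d) (ℕP.m≤n⊔m c d)
  half : ∀ x y → x ℕ.≤ y ℕ.+ 0 ℕ.+ 1 → x ℕ.+ y ℕ.≤ c ℕ.+ d → x ℕ.≤ M
  half x y x≤y+1 x+y≤c+d with x ℕ.≤? M
  ... | yes x≤M = x≤M
  ... | no x≰M  = ⊥-elim (ℕP.<-irrefl refl (ℕP.<-≤-trans too-big (begin
      x ℕ.+ x                  ≤⟨ ℕP.+-monoʳ-≤ x x≤y+1 ⟩
      x ℕ.+ (y ℕ.+ 0 ℕ.+ 1)    ≡⟨ cong (λ z → x ℕ.+ (z ℕ.+ 1)) (ℕP.+-identityʳ y) ⟩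
      x ℕ.+ (y ℕ.+ 1)          ≡⟨ ℕP.+-assoc x y 1 ⟨
      x ℕ.+ y ℕ.+ 1            ≤⟨ ℕP.+-monoˡ-≤ 1 (ℕP.≤-trans x+y≤c+d c+d≤M+M) ⟩
      M ℕ.+ M ℕ.+ 1            ≡⟨ ℕP.+-comm (M ℕ.+ M) 1 ⟩
      suc (M ℕ.+ M)            ∎)))
    where
    open ℕP.≤-Reasoning
    too-big : suc (M ℕ.+ M) ℕ.< x ℕ.+ x
    too-big = ℕP.<-≤-trans (ℕ.s≤s (ℕP.≤-reflexive (sym (ℕP.+-suc M M)))) (ℕP.+-mono-≤ (ℕP.≰⇒> x≰M) (ℕP.≰⇒> x≰M))

-- A string that agrees at every position with s₁ or with s₂ and whose
-- distances to them differ by at most one is a closest string for {s₁, s₂}: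
-- its distance sum d(s₁, s₂) is minimal by the triangle inequality.
balanced-median-closest : ∀ {q n} (s₁ s₂ t : Str q n) → (∀ j → t j ≡ s₁ j ⊎ t j ≡ s₂ j) →
                          Balanced (hamming t s₁) (hamming t s₂) 0 → IsClosest s₁ s₂ t
balanced-median-closest s₁ s₂ t follows balanced u = max-≤-of-sum {c = hamming u s₁} {hamming u s₂} balanced (begin
  hamming t s₁ ℕ.+ hamming t s₂
    ≡⟨ cong₂ ℕ._+_ (hamming≡sum t s₁) (hamming≡sum t s₂) ⟩
  sum (λ j → mismatch (t j) (s₁ j)) ℕ.+ sum (λ j → mismatch (t j) (s₂ j))
    ≡⟨ ∑-distrib-+ (λ j → mismatch (t j) (s₁ j)) (λ j → mismatch (t j) (s₂ j)) ⟨
  sum (λ j → mismatch (t j) (s₁ j) ℕ.+ mismatch (t j) (s₂ j))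
    ≤⟨ sum-mono position ⟩
  sum (λ j → mismatch (u j) (s₁ j) ℕ.+ mismatch (u j) (s₂ j))
    ≡⟨ ∑-distrib-+ (λ j → mismatch (u j) (s₁ j)) (λ j → mismatch (u j) (s₂ j)) ⟩
  sum (λ j → mismatch (u j) (s₁ j)) ℕ.+ sum (λ j → mismatch (u j) (s₂ j))
    ≡⟨ cong₂ ℕ._+_ (hamming≡sum u s₁) (hamming≡sum u s₂) ⟨
  hamming u s₁ ℕ.+ hamming u s₂ ∎)
  where
  open ℕP.≤-Reasoning
  position : ∀ j → mismatch (t j) (s₁ j) ℕ.+ mismatch (t j) (s₂ j) ℕ.≤ mismatch (u j) (s₁ j) ℕ.+ mismatch (u j) (s₂ j)
  position j with follows j
  ... | inj₁ tj≡s₁ rewrite tj≡s₁ | mismatch-refl (s₁ j) = mismatch-triangle (s₁ j) (u j) (s₂ j)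
  ... | inj₂ tj≡s₂ rewrite tj≡s₂ | mismatch-refl (s₂ j) | ℕP.+-identityʳ (mismatch (s₂ j) (s₁ j)) =
    subst (mismatch (s₂ j) (s₁ j) ℕ.≤_) (ℕP.+-comm (mismatch (u j) (s₂ j)) _) (mismatch-triangle (s₂ j) (u j) (s₁ j))

fixedDist-output : ∀ {q n} {F : State q n} {t} → Output F t → ∀ u → fixedDist F u ≡ hamming t u
fixedDist-output {t = t} output u =
  trans (sum-cong-≗ (λ j → cong (λ m → fixedMismatch m (u j)) (output j))) (sym (hamming≡sum t u))

freeDist-output : ∀ {q n} {F : State q n} {t} → Output F t → ∀ u v → freeDist F u v ≡ 0
freeDist-output {n = n} output u v =
  trans (sum-cong-≗ (λ j → cong (λ m → freeMismatch m (u j) (v j)) (output j))) (sum-replicate-zero n)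

theorem1 : (q n : ℕ) (s₁ s₂ : Str q n) → ¬ (∀ j → s₁ j ≡ s₂ j) →
           (run : ℕ → State q n) → IsRun s₁ s₂ run →
           Σ (Str q n) λ t → Output (run n) t × IsClosest s₁ s₂ t
theorem1 q n s₁ s₂ _ run isRun = t , output , closest
  where
  open Invariant (invariant-run run isRun n ℕP.≤-refl)
  t : Str q n
  t = proj₁ (read-off (run n) fixed-count)
  output : Output (run n) t
  output = proj₂ (read-off (run n) fixed-count)
  closest : IsClosest s₁ s₂ t
  closest = balanced-median-closest s₁ s₂ t (λ j → follows j (t j) (output j))
    (balanced-resp (fixedDist-output output s₁) (fixedDist-output output s₂) (freeDist-output output s₁ s₂) balanced)
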